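{- Let $v\ge4$. As formal power series in $y$, \[1+\sum_{d=1}^\infty \sum_{D \in \mathcal{D}_{v,d}(132,213,321)} x^{des(\pi_D)}y^d = \frac{1-y+xy^2}{(1-y)^2}.\]
   Context: A diamond with $v$ vertices ($v\ge4$) is the poset with a least element, a greatest element, and $v-2$ pairwise incomparable middle elements (in a fixed left-to-right order) strictly between them. $\mathcal{D}_{v,d}$ is the set of labellings of $d$ diamonds (placed left to right) by $1,\dots,vd$, each label used once, such that in each diamond least label $<$ each middle label $<$ greatest label. For $D\in\mathcal{D}_{v,d}$, $\pi_D$ is the permutation obtained by reading the diamonds left to right and, within each diamond, the least element, then the middle elements left to right, then the greatest element. $\mathcal{D}_{v,d}(P)$ is the set of $D$ with $\pi_D$ avoiding every classical pattern in $P$. $des(\pi)$ is the number of $i$ with $\pi_i>\pi_{i+1}$. -}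

module Defs where

open import Data.Nat using (ℕ; zero; suc; _+_; _*_; _∸_; _<ᵇ_; _≡ᵇ_)
open import Data.Bool using (Bool; true; false; _∧_; _∨_; not; if_then_else_)
open import Data.Bool.ListAction using (all; any)
open import Data.List using (List; []; _∷_; map; length; filter; concatMap; reverse; take; drop; zip; upTo; cartesianProduct)
open import Data.Product using (_×_; _,_)
open import Data.Integer as ℤ using (ℤ)
open import Relation.Nullary.Decidable using (T?)

insertions : ℕ → List ℕ → List (List ℕ)
insertions x [] = (x ∷ []) ∷ []
insertions x (y ∷ ys) = (x ∷ y ∷ ys) ∷ map (y ∷_) (insertions x ys)

perms : List ℕ → List (List ℕ)
perms [] = [] ∷ []
perms (x ∷ xs) = concatMap (insertions x) (perms xs)

labels : ℕ → List ℕ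
labels n = map suc (upTo n)

subseqs : List ℕ → List (List ℕ)
subseqs [] = [] ∷ []
subseqs (x ∷ xs) = let r = subseqs xs in map (x ∷_) r Data.List.++ r

_==_ : Bool → Bool → Bool
true == b = b
false == b = not b

orderIso : List ℕ → List ℕ → Bool
orderIso s p =
  (length s ≡ᵇ length p) ∧
  all (λ { ((a , b) , (c , e)) → (a <ᵇ c) == (b <ᵇ e) })
      (cartesianProduct (zip s p) (zip s p))

contains : List ℕ → List ℕ → Bool
contains π p = any (λ s → orderIso s p) (subseqs π)

avoidsAll : List (List ℕ) → List ℕ → Bool
avoidsAll P π = all (λ p → not (contains π p)) P

des : List ℕ → ℕ
des [] = 0
des (x ∷ []) = 0
des (x ∷ y ∷ ys) = (if y <ᵇ x then 1 else 0) + des (y ∷ ys)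

-- A labelling D ∈ 𝒟_{v,d} is identified with its reading
-- word π_D: a rearrangement of 1..vd, cut into d consecutive blocks of
-- length v; block = (least, middles left-to-right, greatest).

firstMin : List ℕ → Bool
firstMin [] = true
firstMin (x ∷ xs) = all (x <ᵇ_) xs

firstMax : List ℕ → Bool
firstMax [] = true
firstMax (x ∷ xs) = all (_<ᵇ x) xs

diamondOK : List ℕ → Bool
diamondOK w = firstMin w ∧ firstMax (reverse w)

diamondsOK : ℕ → ℕ → List ℕ → Bool
diamondsOK v zero w = true
diamondsOK v (suc d) w = diamondOK (take v w) ∧ diamondsOK v d (drop v w)

diamondWords : ℕ → ℕ → List (List ℕ)
diamondWords v d = filter (λ π → T? (diamondsOK v d π)) (perms (labels (v * d)))

P : List (List ℕ)
P = (1 ∷ 3 ∷ 2 ∷ []) ∷ (2 ∷ 1 ∷ 3 ∷ []) ∷ (3 ∷ 2 ∷ 1 ∷ []) ∷ []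

count : ℕ → ℕ → ℕ → ℕ
count v d k = length (filter (λ π → T? (avoidsAll P π ∧ (des π ≡ᵇ k))) (diamondWords v d))

-- Formal power series in x, y with integer coefficients:
-- f d k = coefficient of x^k y^d.

Series : Set
Series = ℕ → ℕ → ℤ

sumTo : ℕ → (ℕ → ℤ) → ℤ
sumTo zero f = f 0
sumTo (suc n) f = sumTo n f ℤ.+ f (suc n)

_⊛_ : Series → Series → Series
(f ⊛ g) d k = sumTo d (λ i → sumTo k (λ j → f i j ℤ.* g (d ∸ i) (k ∸ j)))

_⊕_ : Series → Series → Series
(f ⊕ g) d k = f d k ℤ.+ g d k

mono : ℤ → ℕ → ℕ → Series
mono c a b d k = if (d ≡ᵇ b) ∧ (k ≡ᵇ a) then c else ℤ.0ℤ

lhs : ℕ → Series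
lhs v zero k = if k ≡ᵇ 0 then ℤ.1ℤ else ℤ.0ℤ
lhs v (suc d) k = ℤ.+ count v (suc d) k

numer : Series
numer = mono ℤ.1ℤ 0 0 ⊕ (mono ℤ.-1ℤ 0 1 ⊕ mono ℤ.1ℤ 1 2)

oneMinusY : Series
oneMinusY = mono ℤ.1ℤ 0 0 ⊕ mono ℤ.-1ℤ 0 1

-- A word avoids 132, 213 and 321 when each of its triples of entries appears in one of the
-- cyclic orders 123, 231, 312. Inserting the minimum into the avoiders on {2, …, n} shows
-- that the avoiders in Sₙ are the identity and the n − 1 rotations (j+1, …, n, 1, …, j)
-- (Simion–Schmidt). A diamond block straddling the cut of a rotation starts with a label
-- larger than one it contains, so a rotation is a labelling exactly when v ∣ j. Among d
-- diamonds this leaves the identity, with no descent, and d − 1 rotations with one descent: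
-- the series is 1/(1 − y) + xy²/(1 − y)², and multiplying by (1 − y)² is a second difference.

module Submission where

open import Defs
open import Data.Bool using (Bool; true; false; _∧_; not; T)
open import Data.Bool.Properties using (T-∧; T-≡; T-not-≡; ∧-comm; ∧-assoc)
open import Data.List using (List; []; _∷_; _++_; map; length; filter; concatMap; zip; iterate; take;
  drop; reverse; applyUpTo)
open import Data.List.Properties using (filter-++; filter-≐; filter-accept; filter-reject;
  filter-none; filter-all; map-++; map-id; map-∘; ++-identityʳ; ++-assoc; length-drop;
  length-iterate; take-all; reverse-++; map-applyUpTo)
open import Data.List.Membership.Propositional using (_∈_; lose; find)
open import Data.List.Membership.Propositional.Properties using (∈-cartesianProduct⁺; ∈-map⁺; ∈-map⁻;
  ∈-++⁺ˡ; ∈-++⁺ʳ; ∈-++⁻)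
open import Data.List.Relation.Unary.All as All using (All; []; _∷_)
open import Data.List.Relation.Unary.All.Properties using (all⁺; all⁻)
open import Data.List.Relation.Unary.Any using (here; there)
open import Data.List.Relation.Unary.Any.Properties using (any⁺; any⁻; reverse⁻)
open import Data.List.Relation.Binary.Sublist.Propositional using (_⊆_; []; _∷_; _∷ʳ_; ⊆-refl;
  ⊆-trans; to∈; from∈; minimum)
open import Data.List.Relation.Binary.Sublist.Propositional.Properties using (∷ˡ⁻; ++⁺ˡ)
open import Data.Nat using (ℕ; NonZero; zero; suc; _+_; _*_; _∸_; _≤_; _<_; _<ᵇ_; _≡ᵇ_; z<s; z≤n;
  s≤s)
open import Data.Nat.Properties using (<-asym; <ᵇ⇒<; <⇒<ᵇ; <⇒≱; <-trans; ≡ᵇ⇒≡; ≤-refl; ≤-trans;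
  <-≤-trans; <⇒≤; m<m+n; +-suc; +-comm; ≤-reflexive; n<1+n; m≤n+m; m≤m+n; m+n∸m≡n; +-identityʳ;
  *-identityˡ; ≤-pred; +-assoc; m+[n∸m]≡n; m+n∸n≡m; *-cancelʳ-≤; *-distribʳ-∸; *-comm; m<n⇒m<1+n;
  m≤n⇒m≤1+n; n∸n≡0; +-∸-assoc)
open import Data.Integer as ℤ using (ℤ; +_; -[1+_]; 0ℤ; 1ℤ) renaming (_+_ to _+ℤ_; _*_ to _*ℤ_)
import Data.Integer.Properties as ℤ
open import Data.Integer.Tactic.RingSolver using (solve-∀)
open import Data.Product using (_×_; _,_; ∃; ∃₂; proj₁; proj₂)
open import Data.Sum using (inj₁; inj₂)
open import Function using (id; _∘_; Equivalence)
open import Relation.Nullary using (¬_; Dec)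
open import Relation.Nullary.Decidable using (T?)
open import Relation.Binary.PropositionalEquality using (_≡_; refl; sym; trans; cong; cong₂; subst;
  module ≡-Reasoning)

module _ {A : Set} where

  filter-filter : (f g : A → Bool) → ∀ xs →
    filter (T? ∘ g) (filter (T? ∘ f) xs) ≡ filter (λ x → T? (f x ∧ g x)) xs
  filter-filter f g [] = refl
  filter-filter f g (x ∷ xs) with f x
  ... | false = filter-filter f g xs
  ... | true with g x
  ...   | true  = cong (x ∷_) (filter-filter f g xs)
  ...   | false = filter-filter f g xs

  filter-comm : (f g : A → Bool) → ∀ xs →
    filter (T? ∘ g) (filter (T? ∘ f) xs) ≡ filter (T? ∘ f) (filter (T? ∘ g) xs)
  filter-comm f g xs = begin
    filter (T? ∘ g) (filter (T? ∘ f) xs)  ≡⟨ filter-filter f g xs ⟩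
    filter (λ x → T? (f x ∧ g x)) xs      ≡⟨ filter-≐ _ _ (∧-swap f g , ∧-swap g f) xs ⟩
    filter (λ x → T? (g x ∧ f x)) xs      ≡⟨ filter-filter g f xs ⟨
    filter (T? ∘ f) (filter (T? ∘ g) xs)  ∎
    where
    open ≡-Reasoning
    ∧-swap : (h k : A → Bool) → ∀ {x} → T (h x ∧ k x) → T (k x ∧ h x)
    ∧-swap h k {x} = subst T (∧-comm (h x) (k x))

  take-++ : ∀ n (xs ys : List A) → n ≤ length xs → take n (xs ++ ys) ≡ take n xs
  take-++ zero xs ys _ = refl
  take-++ (suc n) (x ∷ xs) ys (s≤s n≤) = cong (x ∷_) (take-++ n xs ys n≤)

  drop-++ : ∀ n (xs ys : List A) → n ≤ length xs → drop n (xs ++ ys) ≡ drop n xs ++ ys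
  drop-++ zero xs ys _ = refl
  drop-++ (suc n) (x ∷ xs) ys (s≤s n≤) = drop-++ n xs ys n≤

  ∈-take-++ : ∀ {y} n (xs ys : List A) → length xs < n → y ∈ take n (xs ++ y ∷ ys)
  ∈-take-++ (suc n) [] ys _ = here refl
  ∈-take-++ (suc n) (x ∷ xs) ys (s≤s xs<n) = there (∈-take-++ n xs ys xs<n)

  ⊆-++⁻ : ∀ {s : List A} U {W} → s ⊆ U ++ W → ∃₂ λ s₁ s₂ → s₁ ++ s₂ ≡ s × s₁ ⊆ U × s₂ ⊆ W
  ⊆-++⁻ [] s⊆W = [] , _ , refl , [] , s⊆W
  ⊆-++⁻ (u ∷ U) (_ ∷ʳ s⊆) =
    let s₁ , s₂ , eq , s₁⊆U , s₂⊆W = ⊆-++⁻ U s⊆ in s₁ , s₂ , eq , u ∷ʳ s₁⊆U , s₂⊆W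
  ⊆-++⁻ (u ∷ U) (refl ∷ s⊆) =
    let s₁ , s₂ , eq , s₁⊆U , s₂⊆W = ⊆-++⁻ U s⊆ in u ∷ s₁ , s₂ , cong (u ∷_) eq , refl ∷ s₁⊆U , s₂⊆W

module _ {A B : Set} where

  filter-concatMap : (p : B → Bool) (f : A → List B) → ∀ xs →
    filter (T? ∘ p) (concatMap f xs) ≡ concatMap (filter (T? ∘ p) ∘ f) xs
  filter-concatMap p f [] = refl
  filter-concatMap p f (x ∷ xs) =
    trans (filter-++ (T? ∘ p) (f x) _) (cong (filter (T? ∘ p) (f x) ++_) (filter-concatMap p f xs))

  concatMap-filter : (p : A → Bool) (f : A → List B) → (∀ x → ¬ T (p x) → f x ≡ []) → ∀ xs →
    concatMap f (filter (T? ∘ p) xs) ≡ concatMap f xs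
  concatMap-filter p f null [] = refl
  concatMap-filter p f null (x ∷ xs) with p x in px
  ... | true  = cong (f x ++_) (concatMap-filter p f null xs)
  ... | false rewrite null x (subst T px) = concatMap-filter p f null xs

T-not⁻ : ∀ {b} → T (not b) → ¬ T b
T-not⁻ {false} _ ()

T-not⁺ : ∀ {b} → ¬ T b → T (not b)
T-not⁺ {false} _ = _
T-not⁺ {true} ¬b = ¬b _

==⇒≡ : ∀ {a b} → T (a == b) → a ≡ b
==⇒≡ {true}  {true}  _ = refl
==⇒≡ {false} {false} _ = refl

<ᵇ-true : ∀ {m n} → m < n → (m <ᵇ n) ≡ true
<ᵇ-true m<n = Equivalence.to T-≡ (<⇒<ᵇ m<n)

<ᵇ-false : ∀ {m n} → n ≤ m → (m <ᵇ n) ≡ false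
<ᵇ-false {m} {n} n≤m = Equivalence.to T-not-≡ (T-not⁺ (λ m<n → <⇒≱ (<ᵇ⇒< m n m<n) n≤m))

∈-subseqs⁺ : ∀ {s w} → s ⊆ w → s ∈ subseqs w
∈-subseqs⁺ [] = here refl
∈-subseqs⁺ {w = x ∷ w} (x ∷ʳ s⊆w) = ∈-++⁺ʳ (map (x ∷_) (subseqs w)) (∈-subseqs⁺ s⊆w)
∈-subseqs⁺ (refl ∷ s⊆w) = ∈-++⁺ˡ (∈-map⁺ (_ ∷_) (∈-subseqs⁺ s⊆w))

∈-subseqs⁻ : ∀ {s} w → s ∈ subseqs w → s ⊆ w
∈-subseqs⁻ [] (here refl) = []
∈-subseqs⁻ (x ∷ w) s∈ with ∈-++⁻ (map (x ∷_) (subseqs w)) s∈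
... | inj₂ s∈′ = x ∷ʳ ∈-subseqs⁻ w s∈′
... | inj₁ s∈′ with ∈-map⁻ (x ∷_) s∈′
...   | _ , s∈″ , refl = refl ∷ ∈-subseqs⁻ w s∈″

orderIso-length : ∀ {s p} → T (orderIso s p) → length s ≡ length p
orderIso-length {s} {p} iso = ≡ᵇ⇒≡ (length s) (length p) (proj₁ (Equivalence.to T-∧ iso))

orderIso-<ᵇ : ∀ {s p a b c e} → T (orderIso s p) → (a , b) ∈ zip s p → (c , e) ∈ zip s p →
  (a <ᵇ c) ≡ (b <ᵇ e)
orderIso-<ᵇ iso ab ce =
  ==⇒≡ (All.lookup (all⁺ _ _ (proj₂ (Equivalence.to T-∧ iso))) (∈-cartesianProduct⁺ ab ce))

orderIso-< : ∀ s p → T (orderIso s p) → ∀ {a b c e} → (a , b) ∈ zip s p → (c , e) ∈ zip s p →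
  T (b <ᵇ e) → a < c
orderIso-< s p iso {a} {c = c} ab ce b<e = <ᵇ⇒< a c (subst T (sym (orderIso-<ᵇ iso ab ce)) b<e)

contains⁺ : ∀ {s w} p → s ⊆ w → T (orderIso s p) → T (contains w p)
contains⁺ p s⊆w iso = any⁺ _ (lose (∈-subseqs⁺ s⊆w) iso)

contains⁻ : ∀ w p → T (contains w p) → ∃ λ s → s ⊆ w × T (orderIso s p)
contains⁻ w p c with find (any⁻ _ (subseqs w) c)
... | s , s∈ , iso = s , ∈-subseqs⁻ w s∈ , iso

avoidsAll⇒¬contains : ∀ {Q w p} → T (avoidsAll Q w) → p ∈ Q → ¬ T (contains w p)
avoidsAll⇒¬contains av p∈Q = T-not⁻ (All.lookup (all⁺ _ _ av) p∈Q)

¬contains⇒avoidsAll : ∀ {Q w} → (∀ {p} → p ∈ Q → ¬ T (contains w p)) → T (avoidsAll Q w)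
¬contains⇒avoidsAll h = all⁻ _ (All.tabulate (T-not⁺ ∘ h))

avoidsAll-⊆ : ∀ {Q u w} → u ⊆ w → T (avoidsAll Q w) → T (avoidsAll Q u)
avoidsAll-⊆ {Q} {u} {w} u⊆w av = ¬contains⇒avoidsAll {Q} {u} λ {p} p∈Q c →
  let s , s⊆u , iso = contains⁻ u p c in
  avoidsAll⇒¬contains {Q} {w} av p∈Q (contains⁺ {w = w} p (⊆-trans s⊆u u⊆w) iso)

data Cyclic (x y z : ℕ) : Set where
  shape-123 : x < y → y < z → Cyclic x y z
  shape-231 : z < x → x < y → Cyclic x y z
  shape-312 : y < z → z < x → Cyclic x y z

data Anticyclic (x y z : ℕ) : Set where
  shape-132 : x < z → z < y → Anticyclic x y z
  shape-213 : y < x → x < z → Anticyclic x y z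
  shape-321 : z < y → y < x → Anticyclic x y z

¬cyclic×anticyclic : ∀ {x y z} → Cyclic x y z → ¬ Anticyclic x y z
¬cyclic×anticyclic (shape-123 _ y<z) (shape-132 _ z<y) = <-asym y<z z<y
¬cyclic×anticyclic (shape-231 z<x _) (shape-132 x<z _) = <-asym z<x x<z
¬cyclic×anticyclic (shape-312 y<z _) (shape-132 _ z<y) = <-asym y<z z<y
¬cyclic×anticyclic (shape-123 x<y _) (shape-213 y<x _) = <-asym x<y y<x
¬cyclic×anticyclic (shape-231 z<x _) (shape-213 _ x<z) = <-asym z<x x<z
¬cyclic×anticyclic (shape-312 _ z<x) (shape-213 _ x<z) = <-asym z<x x<z
¬cyclic×anticyclic (shape-123 x<y _) (shape-321 _ y<x) = <-asym x<y y<x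
¬cyclic×anticyclic (shape-231 _ x<y) (shape-321 _ y<x) = <-asym x<y y<x
¬cyclic×anticyclic (shape-312 y<z _) (shape-321 z<y _) = <-asym y<z z<y

pattern 1st = here refl
pattern 2nd = there (here refl)
pattern 3rd = there (there (here refl))

realises-anticyclic : ∀ {x y z p} → p ∈ P → T (orderIso (x ∷ y ∷ z ∷ []) p) → Anticyclic x y z
realises-anticyclic {x} {y} {z} 1st iso = shape-132 (lt 1st 3rd _) (lt 3rd 2nd _)
  where lt = orderIso-< (x ∷ y ∷ z ∷ []) (1 ∷ 3 ∷ 2 ∷ []) iso
realises-anticyclic {x} {y} {z} 2nd iso = shape-213 (lt 2nd 1st _) (lt 1st 3rd _)
  where lt = orderIso-< (x ∷ y ∷ z ∷ []) (2 ∷ 1 ∷ 3 ∷ []) iso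
realises-anticyclic {x} {y} {z} 3rd iso = shape-321 (lt 3rd 2nd _) (lt 2nd 1st _)
  where lt = orderIso-< (x ∷ y ∷ z ∷ []) (3 ∷ 2 ∷ 1 ∷ []) iso

AllTriplesCyclic : List ℕ → Set
AllTriplesCyclic w = ∀ {x y z} → x ∷ y ∷ z ∷ [] ⊆ w → Cyclic x y z

allTriplesCyclic⇒avoids : ∀ {w} → AllTriplesCyclic w → T (avoidsAll P w)
allTriplesCyclic⇒avoids {w} cyc = ¬contains⇒avoidsAll {P} {w} λ {p} p∈P c →
  let s , s⊆w , iso = contains⁻ w p c in
  triple-avoids s s⊆w p∈P (trans (orderIso-length {s} {p} iso) (P-length p∈P)) iso
  where
  P-length : ∀ {p} → p ∈ P → length p ≡ 3
  P-length 1st = refl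
  P-length 2nd = refl
  P-length 3rd = refl

  triple-avoids : ∀ {p} s → s ⊆ w → p ∈ P → length s ≡ 3 → ¬ T (orderIso s p)
  triple-avoids (x ∷ y ∷ z ∷ []) s⊆w p∈P _ = ¬cyclic×anticyclic (cyc s⊆w) ∘ realises-anticyclic p∈P
  triple-avoids [] _ _ ()
  triple-avoids (_ ∷ []) _ _ ()
  triple-avoids (_ ∷ _ ∷ []) _ _ ()
  triple-avoids (_ ∷ _ ∷ _ ∷ _ ∷ _) _ _ ()

∈-iterate-suc : ∀ {x} a n → x ∈ iterate suc a n → a ≤ x × x < a + n
∈-iterate-suc a (suc n) (here refl) = ≤-refl , m<m+n a z<s
∈-iterate-suc {x} a (suc n) (there x∈) =
  let a<x , x<1+a+n = ∈-iterate-suc (suc a) n x∈ in <⇒≤ a<x , subst (x <_) (sym (+-suc a n)) x<1+a+n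

iterate-suc-< : ∀ {x y s} a n → x ∷ y ∷ s ⊆ iterate suc a n → x < y
iterate-suc-< a (suc n) (_ ∷ʳ xys⊆) = iterate-suc-< (suc a) n xys⊆
iterate-suc-< a (suc n) (refl ∷ ys⊆) = proj₁ (∈-iterate-suc (suc a) n (to∈ ys⊆))

iterate-suc-+ : ∀ a m n → iterate suc a (m + n) ≡ iterate suc a m ++ iterate suc (a + m) n
iterate-suc-+ a zero n = cong (λ b → iterate suc b n) (sym (+-identityʳ a))
iterate-suc-+ a (suc m) n =
  cong (a ∷_) (trans (iterate-suc-+ (suc a) m n)
                     (cong (λ b → iterate suc (suc a) m ++ iterate suc b n) (sym (+-suc a m))))

rotation : ℕ → ℕ → ℕ → List ℕ
rotation a j h = iterate suc (j + a) h ++ iterate suc a j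

module _ (a j h : ℕ) where

  private
    lower<upper : ∀ {l u} → l ∈ iterate suc a j → u ∈ iterate suc (j + a) h → l < u
    lower<upper l∈ u∈ = <-≤-trans (proj₂ (∈-iterate-suc a j l∈))
      (≤-trans (≤-reflexive (+-comm a j)) (proj₁ (∈-iterate-suc (j + a) h u∈)))

  rotation-allTriplesCyclic : AllTriplesCyclic (rotation a j h)
  rotation-allTriplesCyclic xyz⊆ with ⊆-++⁻ (iterate suc (j + a) h) xyz⊆
  ... | [] , _ , refl , _ , xyz⊆W =
    shape-123 (iterate-suc-< a j xyz⊆W) (iterate-suc-< a j (∷ˡ⁻ xyz⊆W))
  ... | _ ∷ [] , _ , refl , x⊆U , yz⊆W =
    shape-312 (iterate-suc-< a j yz⊆W) (lower<upper (to∈ (∷ˡ⁻ yz⊆W)) (to∈ x⊆U))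
  ... | _ ∷ _ ∷ [] , _ , refl , xy⊆U , z⊆W =
    shape-231 (lower<upper (to∈ z⊆W) (to∈ xy⊆U)) (iterate-suc-< (j + a) h xy⊆U)
  ... | _ ∷ _ ∷ _ ∷ [] , _ , refl , xyz⊆U , _ =
    shape-123 (iterate-suc-< (j + a) h xyz⊆U) (iterate-suc-< (j + a) h (∷ˡ⁻ xyz⊆U))
  ... | _ ∷ _ ∷ _ ∷ _ ∷ _ , _ , () , _ , _

rotations : ℕ → ℕ → ℕ → List (List ℕ)
rotations a j zero = []
rotations a j (suc m) = rotation a j (suc m) ∷ rotations a (suc j) m

module _ {a b c} (a<b : a < b) (b<c : b < c) where

  anticyclic-realisations :
    T (orderIso (a ∷ c ∷ b ∷ []) (1 ∷ 3 ∷ 2 ∷ [])) ×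
    T (orderIso (b ∷ a ∷ c ∷ []) (2 ∷ 1 ∷ 3 ∷ [])) ×
    T (orderIso (c ∷ b ∷ a ∷ []) (3 ∷ 2 ∷ 1 ∷ []))
  anticyclic-realisations
    rewrite <ᵇ-false (≤-refl {a}) | <ᵇ-false (≤-refl {b}) | <ᵇ-false (≤-refl {c})
          | <ᵇ-true a<b | <ᵇ-true b<c | <ᵇ-true (<-trans a<b b<c)
          | <ᵇ-false (<⇒≤ a<b) | <ᵇ-false (<⇒≤ b<c) | <ᵇ-false (<⇒≤ (<-trans a<b b<c)) = _ , _ , _

insertionsBefore : ℕ → List ℕ → List (List ℕ)
insertionsBefore x [] = []
insertionsBefore x (y ∷ ys) = (x ∷ y ∷ ys) ∷ map (y ∷_) (insertionsBefore x ys)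

insertions≡insertionsBefore∷ʳ : ∀ x ys → insertions x ys ≡ insertionsBefore x ys ++ (ys ++ x ∷ []) ∷ []
insertions≡insertionsBefore∷ʳ x [] = refl
insertions≡insertionsBefore∷ʳ x (y ∷ ys) = cong ((x ∷ y ∷ ys) ∷_) (begin
  map (y ∷_) (insertions x ys)
    ≡⟨ cong (map (y ∷_)) (insertions≡insertionsBefore∷ʳ x ys) ⟩
  map (y ∷_) (insertionsBefore x ys ++ (ys ++ x ∷ []) ∷ [])
    ≡⟨ map-++ (y ∷_) (insertionsBefore x ys) _ ⟩
  map (y ∷_) (insertionsBefore x ys) ++ (y ∷ ys ++ x ∷ []) ∷ [] ∎)
  where open ≡-Reasoning

insertions-++ : ∀ x U W →
  insertions x (U ++ W) ≡ map (_++ W) (insertionsBefore x U) ++ map (U ++_) (insertions x W)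
insertions-++ x [] W = sym (map-id (insertions x W))
insertions-++ x (u ∷ U) W = cong ((x ∷ u ∷ U ++ W) ∷_) (begin
  map (u ∷_) (insertions x (U ++ W))
    ≡⟨ cong (map (u ∷_)) (insertions-++ x U W) ⟩
  map (u ∷_) (map (_++ W) (insertionsBefore x U) ++ map (U ++_) (insertions x W))
    ≡⟨ map-++ (u ∷_) (map (_++ W) (insertionsBefore x U)) _ ⟩
  map (u ∷_) (map (_++ W) (insertionsBefore x U)) ++ map (u ∷_) (map (U ++_) (insertions x W))
    ≡⟨ cong₂ _++_ (trans (sym (map-∘ (insertionsBefore x U))) (map-∘ (insertionsBefore x U)))
                  (sym (map-∘ (insertions x W))) ⟩
  map (_++ W) (map (u ∷_) (insertionsBefore x U)) ++ map ((u ∷ U) ++_) (insertions x W) ∎)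
  where open ≡-Reasoning

∈-insertionsBefore⁻ : ∀ {z} x ys → z ∈ insertionsBefore x ys →
  ∃₂ λ u y → ∃ λ w → ys ≡ u ++ y ∷ w × z ≡ u ++ x ∷ y ∷ w
∈-insertionsBefore⁻ x (y ∷ ys) (here refl) = [] , y , ys , refl , refl
∈-insertionsBefore⁻ x (y ∷ ys) (there z∈) with ∈-map⁻ (y ∷_) z∈
... | _ , z′∈ , refl with ∈-insertionsBefore⁻ x ys z′∈
...   | u , y′ , w , refl , refl = y ∷ u , y′ , w , refl , refl

insertions-⊇ : ∀ {z} x ys → z ∈ insertions x ys → ys ⊆ z
insertions-⊇ x [] (here refl) = x ∷ʳ []
insertions-⊇ x (y ∷ ys) (here refl) = x ∷ʳ ⊆-refl
insertions-⊇ x (y ∷ ys) (there z∈) with ∈-map⁻ (y ∷_) z∈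
... | _ , z′∈ , refl = refl ∷ insertions-⊇ x ys z′∈

∈-insertions : ∀ {z} x ys → z ∈ insertions x ys → x ∈ z
∈-insertions x [] (here refl) = here refl
∈-insertions x (y ∷ ys) (here refl) = here refl
∈-insertions x (y ∷ ys) (there z∈) with ∈-map⁻ (y ∷_) z∈
... | _ , z′∈ , refl = there (∈-insertions x ys z′∈)

avoiders : List (List ℕ) → List (List ℕ)
avoiders = filter (T? ∘ avoidsAll P)

contains⇒¬avoids : ∀ {p s w} → p ∈ P → s ⊆ w → T (orderIso s p) → ¬ T (avoidsAll P w)
contains⇒¬avoids {p} {w = w} p∈P s⊆w iso av = avoidsAll⇒¬contains {P} {w} av p∈P (contains⁺ p s⊆w iso)

rotation-avoids : ∀ a j h → T (avoidsAll P (rotation a j h))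
rotation-avoids a j h = allTriplesCyclic⇒avoids {rotation a j h} (rotation-allTriplesCyclic a j h)

identity-avoids : ∀ a n → T (avoidsAll P (iterate suc a n))
identity-avoids a n = subst (T ∘ avoidsAll P) (++-identityʳ (iterate suc a n)) (rotation-avoids a 0 n)

avoiders-insertions-identity : ∀ a m → avoiders (insertions a (iterate suc (suc a) (suc m))) ≡
  iterate suc a (2 + m) ∷ rotation a 1 (suc m) ∷ []
avoiders-insertions-identity a m = begin
  avoiders (I ∷ map (suc a ∷_) (insertions a r))
    ≡⟨ filter-accept (T? ∘ avoidsAll P) (identity-avoids a (2 + m)) ⟩
  I ∷ avoiders (map (suc a ∷_) (insertions a r))
    ≡⟨ cong (λ zs → I ∷ avoiders (map (suc a ∷_) zs)) (insertions≡insertionsBefore∷ʳ a r) ⟩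
  I ∷ avoiders (map (suc a ∷_) (insertionsBefore a r ++ (r ++ a ∷ []) ∷ []))
    ≡⟨ cong (λ zs → I ∷ avoiders zs) (map-++ (suc a ∷_) (insertionsBefore a r) _) ⟩
  I ∷ avoiders (map (suc a ∷_) (insertionsBefore a r) ++ rotation a 1 (suc m) ∷ [])
    ≡⟨ cong (I ∷_) (filter-++ (T? ∘ avoidsAll P) (map (suc a ∷_) (insertionsBefore a r)) _) ⟩
  I ∷ (avoiders (map (suc a ∷_) (insertionsBefore a r)) ++ avoiders (rotation a 1 (suc m) ∷ []))
    ≡⟨ cong₂ (λ xs ys → I ∷ xs ++ ys) (filter-none (T? ∘ avoidsAll P) (All.tabulate contains-213))
                                      (filter-accept (T? ∘ avoidsAll P) (rotation-avoids a 1 (suc m))) ⟩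
  I ∷ rotation a 1 (suc m) ∷ [] ∎
  where
  open ≡-Reasoning
  I r : List ℕ
  I = iterate suc a (2 + m)
  r = iterate suc (2 + a) m
  contains-213 : ∀ {z} → z ∈ map (suc a ∷_) (insertionsBefore a r) → ¬ T (avoidsAll P z)
  contains-213 z∈ with ∈-map⁻ (suc a ∷_) z∈
  ... | _ , z′∈ , refl with ∈-insertionsBefore⁻ a r z′∈
  ...   | u , y , w , r≡ , refl =
    contains⇒¬avoids 2nd (refl ∷ ++⁺ˡ u (refl ∷ refl ∷ minimum w))
      (proj₁ (proj₂ (anticyclic-realisations (n<1+n a) 1+a<y)))
    where
    1+a<y : suc a < y
    1+a<y = proj₁ (∈-iterate-suc (2 + a) m (subst (y ∈_) (sym r≡) (∈-++⁺ʳ u (here refl))))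

avoiders-insertions-rotation : ∀ a j m →
  avoiders (insertions a (rotation (suc a) (suc j) (suc m))) ≡ rotation a (2 + j) (suc m) ∷ []
avoiders-insertions-rotation a j m = begin
  avoiders (insertions a (U ++ W))
    ≡⟨ cong avoiders (insertions-++ a U W) ⟩
  avoiders (map (_++ W) (insertionsBefore a U) ++ (U ++ a ∷ W) ∷ map (U ++_) (map (suc a ∷_) (insertions a W′)))
    ≡⟨ filter-++ (T? ∘ avoidsAll P) (map (_++ W) (insertionsBefore a U)) _ ⟩
  avoiders (map (_++ W) (insertionsBefore a U)) ++ avoiders ((U ++ a ∷ W) ∷ map (U ++_) (map (suc a ∷_) (insertions a W′)))
    ≡⟨ cong₂ _++_ (filter-none (T? ∘ avoidsAll P) (All.tabulate contains-132))
                  (filter-accept (T? ∘ avoidsAll P) (subst (T ∘ avoidsAll P) U++a∷W≡ (rotation-avoids a (2 + j) (suc m)))) ⟩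
  (U ++ a ∷ W) ∷ avoiders (map (U ++_) (map (suc a ∷_) (insertions a W′)))
    ≡⟨ cong₂ _∷_ (sym U++a∷W≡) (filter-none (T? ∘ avoidsAll P) (All.tabulate contains-321)) ⟩
  rotation a (2 + j) (suc m) ∷ [] ∎
  where
  open ≡-Reasoning
  U W′ W : List ℕ
  U  = iterate suc (suc j + suc a) (suc m)
  W′ = iterate suc (2 + a) j
  W  = suc a ∷ W′
  U++a∷W≡ : rotation a (2 + j) (suc m) ≡ U ++ a ∷ W
  U++a∷W≡ = cong (λ b → iterate suc b (suc m) ++ a ∷ W) (sym (+-suc (suc j) a))
  1+a<U : ∀ {y} → y ∈ U → suc a < y
  1+a<U y∈ = <-≤-trans (s≤s (m≤n+m (suc a) j)) (proj₁ (∈-iterate-suc (suc j + suc a) (suc m) y∈))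
  contains-132 : ∀ {z} → z ∈ map (_++ W) (insertionsBefore a U) → ¬ T (avoidsAll P z)
  contains-132 z∈ with ∈-map⁻ (_++ W) z∈
  ... | _ , z′∈ , refl with ∈-insertionsBefore⁻ a U z′∈
  ...   | u , y , w , U≡ , refl =
    contains⇒¬avoids 1st
      (subst (_ ⊆_) (sym (++-assoc u (a ∷ y ∷ w) W)) (++⁺ˡ u (refl ∷ refl ∷ ++⁺ˡ w (refl ∷ minimum W′))))
      (proj₁ (anticyclic-realisations (n<1+n a) (1+a<U (subst (y ∈_) (sym U≡) (∈-++⁺ʳ u (here refl))))))
  contains-321 : ∀ {z} → z ∈ map (U ++_) (map (suc a ∷_) (insertions a W′)) → ¬ T (avoidsAll P z)
  contains-321 z∈ with ∈-map⁻ (U ++_) z∈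
  ... | _ , z′∈ , refl with ∈-map⁻ (suc a ∷_) z′∈
  ...   | e , e∈ , refl =
    contains⇒¬avoids 3rd
      (refl ∷ ++⁺ˡ (iterate suc (suc (suc j + suc a)) m) (refl ∷ from∈ (∈-insertions a W′ e∈)))
      (proj₂ (proj₂ (anticyclic-realisations (n<1+n a) (1+a<U (here refl)))))

avoiders-insertions-rotations : ∀ a j m →
  concatMap (avoiders ∘ insertions a) (rotations (suc a) (suc j) m) ≡ rotations a (2 + j) m
avoiders-insertions-rotations a j zero = refl
avoiders-insertions-rotations a j (suc m) =
  cong₂ _++_ (avoiders-insertions-rotation a j m) (avoiders-insertions-rotations a (suc j) m)

avoiders-perms : ∀ a m → avoiders (perms (iterate suc a (suc m))) ≡ iterate suc a (suc m) ∷ rotations a 1 m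
avoiders-perms a zero = filter-accept (T? ∘ avoidsAll P) {xs = []} (identity-avoids a 1)
avoiders-perms a (suc m) = begin
  avoiders (concatMap (insertions a) Y)
    ≡⟨ filter-concatMap (avoidsAll P) (insertions a) Y ⟩
  concatMap (avoiders ∘ insertions a) Y
    ≡⟨ concatMap-filter (avoidsAll P) (avoiders ∘ insertions a) no-new-avoiders Y ⟨
  concatMap (avoiders ∘ insertions a) (avoiders Y)
    ≡⟨ cong (concatMap (avoiders ∘ insertions a)) (avoiders-perms (suc a) m) ⟩
  avoiders (insertions a (iterate suc (suc a) (suc m))) ++ concatMap (avoiders ∘ insertions a) (rotations (suc a) 1 m)
    ≡⟨ cong₂ _++_ (avoiders-insertions-identity a m) (avoiders-insertions-rotations a 0 m) ⟩
  iterate suc a (2 + m) ∷ rotations a 1 (suc m) ∎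
  where
  open ≡-Reasoning
  Y : List (List ℕ)
  Y = perms (iterate suc (suc a) (suc m))
  no-new-avoiders : ∀ y → ¬ T (avoidsAll P y) → avoiders (insertions a y) ≡ []
  no-new-avoiders y ¬av = filter-none (T? ∘ avoidsAll P) {insertions a y}
    (All.tabulate λ {z} z∈ av → ¬av (avoidsAll-⊆ {P} {y} {z} (insertions-⊇ a y z∈) av))

diamondsOK-++ : ∀ v q e (xs ys : List ℕ) → length xs ≡ q * v →
  diamondsOK v (q + e) (xs ++ ys) ≡ diamondsOK v q xs ∧ diamondsOK v e ys
diamondsOK-++ v zero e [] ys _ = refl
diamondsOK-++ v (suc q) e xs ys |xs| = begin
  diamondOK (take v (xs ++ ys)) ∧ diamondsOK v (q + e) (drop v (xs ++ ys))
    ≡⟨ cong₂ (λ t d → diamondOK t ∧ diamondsOK v (q + e) d) (take-++ v xs ys v≤) (drop-++ v xs ys v≤) ⟩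
  diamondOK (take v xs) ∧ diamondsOK v (q + e) (drop v xs ++ ys)
    ≡⟨ cong (diamondOK (take v xs) ∧_) (diamondsOK-++ v q e (drop v xs) ys |drop|) ⟩
  diamondOK (take v xs) ∧ (diamondsOK v q (drop v xs) ∧ diamondsOK v e ys)
    ≡⟨ ∧-assoc (diamondOK (take v xs)) _ _ ⟨
  (diamondOK (take v xs) ∧ diamondsOK v q (drop v xs)) ∧ diamondsOK v e ys ∎
  where
  open ≡-Reasoning
  v≤ : v ≤ length xs
  v≤ = subst (v ≤_) (sym |xs|) (m≤m+n v (q * v))
  |drop| : length (drop v xs) ≡ q * v
  |drop| = trans (length-drop v xs) (trans (cong (_∸ v) |xs|) (m+n∸m≡n v (q * v)))

diamondOK-iterate-suc : ∀ a n → T (diamondOK (iterate suc a n))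
diamondOK-iterate-suc a zero = _
diamondOK-iterate-suc a (suc n) = Equivalence.from T-∧ (firstMin-ok , firstMax-ok)
  where
  firstMin-ok : T (firstMin (iterate suc a (suc n)))
  firstMin-ok = all⁻ _ (All.tabulate λ x∈ → <⇒<ᵇ (proj₁ (∈-iterate-suc (suc a) n x∈)))
  last≡ : iterate suc a (suc n) ≡ iterate suc a n ++ a + n ∷ []
  last≡ = trans (cong (iterate suc a) (+-comm 1 n)) (iterate-suc-+ a n 1)
  firstMax-ok : T (firstMax (reverse (iterate suc a (suc n))))
  firstMax-ok = subst (T ∘ firstMax) (sym (trans (cong reverse last≡) (reverse-++ (iterate suc a n) _)))
    (all⁻ _ (All.tabulate λ x∈ → <⇒<ᵇ (proj₂ (∈-iterate-suc a n (reverse⁻ x∈)))))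

diamondsOK-iterate-suc : ∀ v e a → T (diamondsOK v e (iterate suc a (e * v)))
diamondsOK-iterate-suc v zero a = _
diamondsOK-iterate-suc v (suc e) a =
  subst T (sym (trans (cong (diamondsOK v (1 + e)) (iterate-suc-+ a v (e * v)))
                      (diamondsOK-++ v 1 e (iterate suc a v) _ (trans (length-iterate suc a v) (sym (*-identityˡ v))))))
    (Equivalence.from T-∧ (first-block , diamondsOK-iterate-suc v e (a + v)))
  where
  first-block : T (diamondsOK v 1 (iterate suc a v))
  first-block rewrite take-all v (iterate suc a v) (≤-reflexive (length-iterate suc a v)) =
    Equivalence.from T-∧ (diamondOK-iterate-suc a v , _)

-- The first block starts at c + 1 ≥ 2 but already contains the label 1.
diamondsOK-straddling : ∀ v r e c ys → suc r < v → ¬ T (diamondsOK v (suc e) (iterate suc (suc c) (suc r) ++ 1 ∷ ys))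
diamondsOK-straddling (suc v′) r e c ys 1+r<v ok =
  All.lookup (all⁺ _ _ (proj₁ (Equivalence.to T-∧ (proj₁ (Equivalence.to T-∧ ok)))))
    (∈-take-++ v′ (iterate suc (2 + c) r) ys (subst (_< v′) (sym (length-iterate suc (2 + c) r)) (≤-pred 1+r<v)))

rotation-diamondsOK : ∀ v q e → T (diamondsOK v (q + e) (rotation 1 (e * v) (q * v)))
rotation-diamondsOK v q e =
  subst T (sym (diamondsOK-++ v q e (iterate suc (e * v + 1) (q * v)) _ (length-iterate suc _ (q * v))))
    (Equivalence.from T-∧ (diamondsOK-iterate-suc v q (e * v + 1) , diamondsOK-iterate-suc v e 1))

rotation-¬diamondsOK : ∀ v q r e j → suc r < v → ¬ T (diamondsOK v (q + suc e) (rotation 1 (suc j) (suc r + q * v)))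
rotation-¬diamondsOK v q r e j 1+r<v ok =
  diamondsOK-straddling v r e (j + 1 + q * v) (iterate suc 2 j) 1+r<v
    (proj₂ (Equivalence.to (T-∧ {diamondsOK v q (iterate suc b (q * v))}) (subst T split ok)))
  where
  b : ℕ
  b = suc j + 1
  split : diamondsOK v (q + suc e) (rotation 1 (suc j) (suc r + q * v)) ≡
          diamondsOK v q (iterate suc b (q * v)) ∧ diamondsOK v (suc e) (iterate suc (b + q * v) (suc r) ++ iterate suc 1 (suc j))
  split = begin
    diamondsOK v (q + suc e) (iterate suc b (suc r + q * v) ++ iterate suc 1 (suc j))
      ≡⟨ cong (λ w → diamondsOK v (q + suc e) (w ++ iterate suc 1 (suc j)))
              (trans (cong (iterate suc b) (+-comm (suc r) (q * v))) (iterate-suc-+ b (q * v) (suc r))) ⟩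
    diamondsOK v (q + suc e) ((iterate suc b (q * v) ++ iterate suc (b + q * v) (suc r)) ++ iterate suc 1 (suc j))
      ≡⟨ cong (diamondsOK v (q + suc e)) (++-assoc (iterate suc b (q * v)) _ _) ⟩
    diamondsOK v (q + suc e) (iterate suc b (q * v) ++ iterate suc (b + q * v) (suc r) ++ iterate suc 1 (suc j))
      ≡⟨ diamondsOK-++ v q (suc e) (iterate suc b (q * v)) _ (length-iterate suc b (q * v)) ⟩
    diamondsOK v q (iterate suc b (q * v)) ∧ diamondsOK v (suc e) (iterate suc (b + q * v) (suc r) ++ iterate suc 1 (suc j)) ∎
    where open ≡-Reasoning

multiple-split : ∀ v .{{_ : NonZero v}} x q D → x + q * v ≡ D * v → ∃ λ e → D ≡ q + e × x ≡ e * v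
multiple-split v x q D eq = D ∸ q , sym (m+[n∸m]≡n q≤D) , x≡
  where
  q≤D : q ≤ D
  q≤D = *-cancelʳ-≤ q D v (subst (q * v ≤_) eq (m≤n+m (q * v) x))
  x≡ : x ≡ (D ∸ q) * v
  x≡ = trans (sym (m+n∸n≡m x (q * v))) (trans (cong (_∸ q * v) eq) (sym (*-distribʳ-∸ v D q)))

module _ (v′ : ℕ) where

  private
    v : ℕ
    v = suc v′

  -- The upper runs of these rotations have lengths r + qv, r + qv − 1, …, 1, and
  -- a rotation is a labelling exactly when that length is a multiple of v.
  count-diamond-rotations : ∀ D q r j → r < v → 1 ≤ j → j + (r + q * v) ≡ D * v →
    length (filter (T? ∘ diamondsOK v D) (rotations 1 j (r + q * v))) ≡ q
  count-diamond-rotations D zero zero j _ _ _ = refl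
  count-diamond-rotations D q (suc r) (suc j) 1+r<v _ eq
    with multiple-split v (suc j + suc r) q D (trans (+-assoc (suc j) (suc r) _) eq)
  ... | suc e , refl , _ =
    trans (cong length (filter-reject (T? ∘ diamondsOK v D)
                         {rotation 1 (suc j) (suc r + q * v)} {rotations 1 (2 + j) (r + q * v)}
                         (rotation-¬diamondsOK v q r e j 1+r<v)))
          (count-diamond-rotations D q r (2 + j) (<-trans (n<1+n r) 1+r<v) (s≤s z≤n)
            (trans (sym (+-suc (suc j) (r + q * v))) eq))
  count-diamond-rotations D (suc q) zero j _ _ eq with multiple-split v j (suc q) D eq
  ... | e , refl , refl =
    trans (cong length (filter-accept (T? ∘ diamondsOK v D)
                         {rotation 1 (e * v) (suc q * v)} {rotations 1 (suc (e * v)) (v′ + q * v)}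
                         (rotation-diamondsOK v (suc q) e)))
          (cong suc (count-diamond-rotations D q v′ (suc (e * v)) (n<1+n v′) (s≤s z≤n)
            (trans (sym (+-suc (e * v) (v′ + q * v))) eq)))

des-ascent : ∀ {x y} ys → x < y → des (x ∷ y ∷ ys) ≡ des (y ∷ ys)
des-ascent ys x<y rewrite <ᵇ-false (<⇒≤ x<y) = refl

des-descent : ∀ {x y} ys → y < x → des (x ∷ y ∷ ys) ≡ suc (des (y ∷ ys))
des-descent ys y<x rewrite <ᵇ-true y<x = refl

des-iterate-suc : ∀ a n → des (iterate suc a n) ≡ 0
des-iterate-suc a zero = refl
des-iterate-suc a (suc zero) = refl
des-iterate-suc a (suc (suc n)) =
  trans (des-ascent (iterate suc (2 + a) n) (n<1+n a)) (des-iterate-suc (suc a) (suc n))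

des-runs : ∀ a b h j → a < b → des (iterate suc b (suc h) ++ iterate suc a (suc j)) ≡ 1
des-runs a b zero j a<b =
  trans (des-descent (iterate suc (suc a) j) a<b) (cong suc (des-iterate-suc a (suc j)))
des-runs a b (suc h) j a<b =
  trans (des-ascent (iterate suc (2 + b) h ++ iterate suc a (suc j)) (n<1+n b)) (des-runs a (suc b) h j (m<n⇒m<1+n a<b))

des-rotations : ∀ a j m → All (λ w → des w ≡ 1) (rotations a (suc j) m)
des-rotations a j zero = []
des-rotations a j (suc m) = des-runs a (suc j + a) m j (s≤s (m≤n+m a j)) ∷ des-rotations a (suc j) m

labels≡iterate-suc : ∀ n → labels n ≡ iterate suc 1 n
labels≡iterate-suc n = trans (map-applyUpTo id suc n) (applyUpTo-iterate-suc 1 n (λ i → sym (+-comm i 1)))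
  where
  applyUpTo-iterate-suc : ∀ {g : ℕ → ℕ} a n → (∀ i → g i ≡ i + a) → applyUpTo g n ≡ iterate suc a n
  applyUpTo-iterate-suc a zero _ = refl
  applyUpTo-iterate-suc a (suc n) g≗ =
    cong₂ _∷_ (g≗ 0) (applyUpTo-iterate-suc (suc a) n (λ i → trans (g≗ (suc i)) (sym (+-suc i a))))

module _ (v′ d : ℕ) where

  private
    v : ℕ
    v = suc v′
    diamondsOK? : ∀ π → Dec (T (diamondsOK v (suc d) π))
    diamondsOK? = T? ∘ diamondsOK v (suc d)
    des≡? : ℕ → List ℕ → Bool
    des≡? k π = des π ≡ᵇ k
    identity : List ℕ
    identity = iterate suc 1 (suc d * v)
    rots : List (List ℕ)
    rots = rotations 1 1 (v′ + d * v)

  count≡filter-rotations : ∀ k → count v (suc d) k ≡ length (filter diamondsOK? (filter (T? ∘ des≡? k) (identity ∷ rots)))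
  count≡filter-rotations k = cong length (begin
    filter (λ π → T? (avoidsAll P π ∧ des≡? k π)) (filter diamondsOK? X)
      ≡⟨ filter-comm (diamondsOK v (suc d)) (λ π → avoidsAll P π ∧ des≡? k π) X ⟩
    filter diamondsOK? (filter (λ π → T? (avoidsAll P π ∧ des≡? k π)) X)
      ≡⟨ cong (filter diamondsOK?) (filter-filter (avoidsAll P) (des≡? k) X) ⟨
    filter diamondsOK? (filter (T? ∘ des≡? k) (avoiders X))
      ≡⟨ cong (λ Y → filter diamondsOK? (filter (T? ∘ des≡? k) (avoiders (perms Y))))
              (trans (labels≡iterate-suc (v * suc d)) (cong (iterate suc 1) (*-comm v (suc d)))) ⟩
    filter diamondsOK? (filter (T? ∘ des≡? k) (avoiders (perms identity)))
      ≡⟨ cong (filter diamondsOK? ∘ filter (T? ∘ des≡? k)) (avoiders-perms 1 (v′ + d * v)) ⟩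
    filter diamondsOK? (filter (T? ∘ des≡? k) (identity ∷ rots)) ∎)
    where
    open ≡-Reasoning
    X : List (List ℕ)
    X = perms (labels (v * suc d))

  identity-des₀ : T (des≡? 0 identity)
  identity-des₀ = subst (T ∘ (_≡ᵇ 0)) (sym (des-iterate-suc 1 (suc d * v))) _

  identity-¬des : ∀ {k} → ¬ T (0 ≡ᵇ k) → ¬ T (des≡? k identity)
  identity-¬des {k} 0≢k = 0≢k ∘ subst (T ∘ (_≡ᵇ k)) (des-iterate-suc 1 (suc d * v))

  rots-des₁ : All (T ∘ des≡? 1) rots
  rots-des₁ = All.map (λ des≡1 → subst (T ∘ (_≡ᵇ 1)) (sym des≡1) _) (des-rotations 1 0 (v′ + d * v))

  rots-¬des : ∀ {k} → ¬ T (1 ≡ᵇ k) → All (λ π → ¬ T (des≡? k π)) rots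
  rots-¬des {k} 1≢k = All.map (λ des≡1 → 1≢k ∘ subst (T ∘ (_≡ᵇ k)) des≡1) (des-rotations 1 0 (v′ + d * v))

  count-des≡0 : count v (suc d) 0 ≡ 1
  count-des≡0 = begin
    count v (suc d) 0
      ≡⟨ count≡filter-rotations 0 ⟩
    length (filter diamondsOK? (filter (T? ∘ des≡? 0) (identity ∷ rots)))
      ≡⟨ cong (length ∘ filter diamondsOK?) (filter-accept (T? ∘ des≡? 0) {identity} {rots} identity-des₀) ⟩
    length (filter diamondsOK? (identity ∷ filter (T? ∘ des≡? 0) rots))
      ≡⟨ cong (λ πs → length (filter diamondsOK? (identity ∷ πs))) (filter-none (T? ∘ des≡? 0) {rots} (rots-¬des λ ())) ⟩
    length (filter diamondsOK? (identity ∷ []))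
      ≡⟨ cong length (filter-accept diamondsOK? {identity} {[]} (diamondsOK-iterate-suc v (suc d) 1)) ⟩
    1 ∎
    where open ≡-Reasoning

  count-des≡1 : count v (suc d) 1 ≡ d
  count-des≡1 = begin
    count v (suc d) 1
      ≡⟨ count≡filter-rotations 1 ⟩
    length (filter diamondsOK? (filter (T? ∘ des≡? 1) (identity ∷ rots)))
      ≡⟨ cong (length ∘ filter diamondsOK?) (filter-reject (T? ∘ des≡? 1) {identity} {rots} (identity-¬des λ ())) ⟩
    length (filter diamondsOK? (filter (T? ∘ des≡? 1) rots))
      ≡⟨ cong (length ∘ filter diamondsOK?) (filter-all (T? ∘ des≡? 1) {rots} rots-des₁) ⟩
    length (filter diamondsOK? rots)
      ≡⟨ count-diamond-rotations v′ (suc d) d v′ 1 (n<1+n v′) (s≤s z≤n) refl ⟩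
    d ∎
    where open ≡-Reasoning

  count-des≥2 : ∀ k → count v (suc d) (2 + k) ≡ 0
  count-des≥2 k = begin
    count v (suc d) (2 + k)
      ≡⟨ count≡filter-rotations (2 + k) ⟩
    length (filter diamondsOK? (filter (T? ∘ des≡? (2 + k)) (identity ∷ rots)))
      ≡⟨ cong (length ∘ filter diamondsOK?) (filter-reject (T? ∘ des≡? (2 + k)) {identity} {rots} (identity-¬des λ ())) ⟩
    length (filter diamondsOK? (filter (T? ∘ des≡? (2 + k)) rots))
      ≡⟨ cong (length ∘ filter diamondsOK?) (filter-none (T? ∘ des≡? (2 + k)) {rots} (rots-¬des λ ())) ⟩
    0 ∎
    where open ≡-Reasoning

closedForm : Series
closedForm d zero = 1ℤ
closedForm d (suc zero) = + (d ∸ 1)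
closedForm d (suc (suc k)) = 0ℤ

lhs≡closedForm : ∀ v′ d k → lhs (suc v′) d k ≡ closedForm d k
lhs≡closedForm v′ zero zero = refl
lhs≡closedForm v′ zero (suc zero) = refl
lhs≡closedForm v′ zero (suc (suc k)) = refl
lhs≡closedForm v′ (suc d) zero = cong +_ (count-des≡0 v′ d)
lhs≡closedForm v′ (suc d) (suc zero) = cong +_ (count-des≡1 v′ d)
lhs≡closedForm v′ (suc d) (suc (suc k)) = cong +_ (count-des≥2 v′ d k)

sumTo-cong : ∀ n {f g : ℕ → ℤ} → (∀ i → i ≤ n → f i ≡ g i) → sumTo n f ≡ sumTo n g
sumTo-cong zero f≗g = f≗g 0 z≤n
sumTo-cong (suc n) f≗g = cong₂ _+ℤ_ (sumTo-cong n (λ i i≤n → f≗g i (m≤n⇒m≤1+n i≤n))) (f≗g (suc n) ≤-refl)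

sumTo-zero : ∀ n {f : ℕ → ℤ} → (∀ i → i ≤ n → f i ≡ 0ℤ) → sumTo n f ≡ 0ℤ
sumTo-zero n {f} f≗0 = trans (sumTo-cong n f≗0) (zeros n)
  where
  zeros : ∀ n → sumTo n (λ _ → 0ℤ) ≡ 0ℤ
  zeros zero = refl
  zeros (suc n) = cong (_+ℤ 0ℤ) (zeros n)

sumTo-last : ∀ n {f : ℕ → ℤ} → (∀ i → i < n → f i ≡ 0ℤ) → sumTo n f ≡ f n
sumTo-last zero _ = refl
sumTo-last (suc n) {f} f≗0 =
  trans (cong (_+ℤ f (suc n)) (sumTo-zero n (λ i i≤n → f≗0 i (s≤s i≤n)))) (ℤ.+-identityˡ (f (suc n)))

⊛-congˡ : ∀ {f f′} g → (∀ d k → f d k ≡ f′ d k) → ∀ d k → (f ⊛ g) d k ≡ (f′ ⊛ g) d k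
⊛-congˡ g f≗f′ d k = sumTo-cong d λ i _ → sumTo-cong k λ j _ → cong (_*ℤ g (d ∸ i) (k ∸ j)) (f≗f′ i j)

⊛-constantInXʳ : ∀ f {g} → (∀ d k → g d (suc k) ≡ 0ℤ) → ∀ d k →
  (f ⊛ g) d k ≡ sumTo d (λ i → f i k *ℤ g (d ∸ i) 0)
⊛-constantInXʳ f {g} g-x d k = sumTo-cong d λ i _ →
  trans (sumTo-last k (λ j j<k → trans (cong (f i j *ℤ_) (g-shifted (d ∸ i) j<k)) (ℤ.*-zeroʳ (f i j))))
        (cong (λ t → f i k *ℤ g (d ∸ i) t) (n∸n≡0 k))
  where
  g-shifted : ∀ e {j k} → j < k → g e (k ∸ j) ≡ 0ℤ
  g-shifted e {zero} {suc k} _ = g-x e k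
  g-shifted e {suc j} {suc k} (s≤s j<k) = g-shifted e j<k

oneMinusY²-coeff : ℕ → ℤ
oneMinusY²-coeff 0 = 1ℤ
oneMinusY²-coeff 1 = -[1+ 1 ]
oneMinusY²-coeff 2 = 1ℤ
oneMinusY²-coeff (suc (suc (suc _))) = 0ℤ

oneMinusY²-x : ∀ d k → (oneMinusY ⊛ oneMinusY) d (suc k) ≡ 0ℤ
oneMinusY²-x d k = sumTo-zero d λ i _ → sumTo-zero (suc k) λ j _ → no-x i j
  where
  oneMinusY-x : ∀ i j → oneMinusY i (suc j) ≡ 0ℤ
  oneMinusY-x 0 j = refl
  oneMinusY-x 1 j = refl
  oneMinusY-x (suc (suc i)) j = refl
  no-x : ∀ i j → oneMinusY i j *ℤ oneMinusY (d ∸ i) (suc k ∸ j) ≡ 0ℤ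
  no-x i zero = trans (cong (oneMinusY i 0 *ℤ_) (oneMinusY-x (d ∸ i) k)) (ℤ.*-zeroʳ (oneMinusY i 0))
  no-x i (suc j) rewrite oneMinusY-x i j = refl

oneMinusY²-y : ∀ d → (oneMinusY ⊛ oneMinusY) d 0 ≡ oneMinusY²-coeff d
oneMinusY²-y 0 = refl
oneMinusY²-y 1 = refl
oneMinusY²-y 2 = refl
oneMinusY²-y (suc (suc (suc a))) = sumTo-zero (3 + a) λ where
  0 _ → refl
  1 _ → refl
  (suc (suc i)) _ → refl

sumTo-oneMinusY² : ∀ a (f : ℕ → ℤ) → sumTo (3 + a) (λ i → f i *ℤ oneMinusY²-coeff (3 + a ∸ i)) ≡
  f (1 + a) *ℤ 1ℤ +ℤ f (2 + a) *ℤ -[1+ 1 ] +ℤ f (3 + a) *ℤ 1ℤ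
sumTo-oneMinusY² a f
  rewrite sumTo-zero a (λ i i≤a → trans (cong (λ e → f i *ℤ oneMinusY²-coeff e) (+-∸-assoc 3 i≤a))
                                        (ℤ.*-zeroʳ (f i)))
        | m+n∸n≡m 2 (suc a) | m+n∸n≡m 1 (2 + a) | n∸n≡0 (3 + a)
  = cong (λ t → t +ℤ f (2 + a) *ℤ -[1+ 1 ] +ℤ f (3 + a) *ℤ 1ℤ) (ℤ.+-identityˡ (f (suc a) *ℤ 1ℤ))

numer-x≥2 : ∀ d k → numer d (2 + k) ≡ 0ℤ
numer-x≥2 0 k = refl
numer-x≥2 1 k = refl
numer-x≥2 2 k = refl
numer-x≥2 (suc (suc (suc _))) k = refl

closedForm⊛oneMinusY² : ∀ d k → (closedForm ⊛ (oneMinusY ⊛ oneMinusY)) d k ≡ numer d k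
closedForm⊛oneMinusY² d k = begin
  (closedForm ⊛ (oneMinusY ⊛ oneMinusY)) d k
    ≡⟨ ⊛-constantInXʳ closedForm {oneMinusY ⊛ oneMinusY} oneMinusY²-x d k ⟩
  sumTo d (λ i → closedForm i k *ℤ (oneMinusY ⊛ oneMinusY) (d ∸ i) 0)
    ≡⟨ sumTo-cong d (λ i _ → cong (closedForm i k *ℤ_) (oneMinusY²-y (d ∸ i))) ⟩
  sumTo d (λ i → closedForm i k *ℤ oneMinusY²-coeff (d ∸ i))
    ≡⟨ second-difference d k ⟩
  numer d k ∎
  where
  open ≡-Reasoning
  second-difference : ∀ d k → sumTo d (λ i → closedForm i k *ℤ oneMinusY²-coeff (d ∸ i)) ≡ numer d k
  second-difference 0 0 = refl
  second-difference 1 0 = refl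
  second-difference 2 0 = refl
  second-difference (suc (suc (suc a))) 0 = sumTo-oneMinusY² a (λ _ → 1ℤ)
  second-difference 0 1 = refl
  second-difference 1 1 = refl
  second-difference 2 1 = refl
  second-difference (suc (suc (suc a))) 1 = trans (sumTo-oneMinusY² a (λ i → + (i ∸ 1))) (linear-vanishes (+ a))
    where
    linear-vanishes : ∀ x → x *ℤ 1ℤ +ℤ (1ℤ +ℤ x) *ℤ -[1+ 1 ] +ℤ (1ℤ +ℤ (1ℤ +ℤ x)) *ℤ 1ℤ ≡ 0ℤ
    linear-vanishes = solve-∀
  second-difference d (suc (suc k)) = trans (sumTo-zero d λ _ _ → refl) (sym (numer-x≥2 d k))

theorem4p1 : (v : ℕ) → 4 ≤ v →
    (d k : ℕ) → (lhs v ⊛ (oneMinusY ⊛ oneMinusY)) d k ≡ numer d k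
theorem4p1 (suc v′) _ d k =
  trans (⊛-congˡ (oneMinusY ⊛ oneMinusY) (lhs≡closedForm v′) d k) (closedForm⊛oneMinusY² d k)
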